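{- For every positive integer $k$ there exists a constant $C = C_k$ such that the following holds. Let $T$ be a tournament on $n$ vertices and $(X,Y)$ a partition of its vertex set such that $\overrightarrow{e}(X,Y)\geq C n^{2- 1/ \lceil k/2 \rceil}$. Then there exists a sequence $(x_1, \ldots, x_k, y_1, \ldots, y_k) \in X^k \times Y^k$ of distinct vertices which is the $k$-th power of a path.
   Context: A tournament is an orientation of a complete graph. $\overrightarrow{e}(X,Y)$ is the number of edges of $T$ oriented from $X$ to $Y$. A sequence of vertices $(u_1,\ldots,u_l)$ is the $k$-th power of a path if $u_iu_j$ is an edge of $T$ for all $i<j\le i+k$. -}

module Defs where

open import Data.Nat using (ℕ; zero; suc; _+_; _*_; _^_; _≤_; _<_; ⌈_/2⌉)
open import Data.Bool using (Bool; true; false; not; _∧_; if_then_else_)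
open import Data.Fin using (Fin; toℕ; zero; suc)
open import Relation.Binary.PropositionalEquality using (_≡_; _≢_)
open import Data.Product using (_×_)
open import Function.Definitions using (Injective)

sumFin : (n : ℕ) → (Fin n → ℕ) → ℕ
sumFin zero    f = 0
sumFin (suc n) f = f zero + sumFin n (λ i → f (suc i))

-- A tournament on vertex set Fin n: adj u v ≡ true iff the edge is oriented u → v.
record Tournament (n : ℕ) : Set where
  field
    adj    : Fin n → Fin n → Bool
    irrefl : ∀ u → adj u u ≡ false
    tourn  : ∀ u v → u ≢ v → adj u v ≡ not (adj v u)
open Tournament public

-- A partition (X, Y) of Fin n is given by the indicator of X; Y is its complement.
Part : ℕ → Set
Part n = Fin n → Bool

eXY : {n : ℕ} → Tournament n → Part n → ℕ
eXY {n} T X = sumFin n λ u → sumFin n λ v →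
  if X u ∧ not (X v) ∧ adj T u v then 1 else 0

IsPathPower : {n l : ℕ} → Tournament n → ℕ → (Fin l → Fin n) → Set
IsPathPower T k u = ∀ i j → toℕ i < toℕ j → toℕ j ≤ toℕ i + k → adj T (u i) (u j) ≡ true

-- (u_0..u_{2k-1}) = (x_1..x_k, y_1..y_k) ∈ X^k × Y^k, distinct, and a k-th power of a path
GoodSeq : {n : ℕ} → Tournament n → Part n → (k : ℕ) → (Fin (k + k) → Fin n) → Set
GoodSeq T X k u =
  (∀ i → toℕ i < k → X (u i) ≡ true) ×
  (∀ i → k ≤ toℕ i → X (u i) ≡ false) ×
  Injective _≡_ _≡_ u ×
  IsPathPower T k u

-- Let m = ⌈k/2⌉ and t = ⌊k/2⌋, and call a vertex sequence a chain if each vertex beats all later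
-- ones.  A tournament on s ≥ chainThreshold r vertices contains at least s^r / chainFactor r
-- r-chains, because at most 2L vertices have out-degree below L.  Count pairs (A, B) with A an
-- m-chain in X (read backwards, as x_k, …, x_(t+1)) and B a t-chain in Y inside the common
-- out-neighbourhood of A: two applications of the power-mean inequality turn the bound on
-- e(X, Y) into ≫ n^m such pairs, while only O(n^m) pairs have fewer than a constant number of
-- extensions on either side.  So some pair extends to an m-chain H after B in the common
-- out-neighbourhood of A and a t-chain L after A in the common in-neighbourhood of B.  In
-- (x_1, …, x_k, y_1, …, y_k) = (reverse (A ++ L), B ++ H) the edge x_p y_q is needed only
-- for q ≤ p, so x_p ∈ A or y_q ∈ B, and it is present in both cases.

module Submission where

open import Defs
open import Data.Nat using (ℕ; _+_; _*_; _∸_; _^_; _≤_; ⌈_/2⌉)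
open import Data.Fin using (Fin)
open import Data.Product using (Σ; ∃; _,_)

open import Data.Nat hiding (_≟_)
open import Data.Nat.Properties hiding (_≟_)
open import Data.Nat.DivMod using (m≡m%n+[m/n]*n; m%n<n; m/n*n≤m; m*n/n≡m; /-monoˡ-≤)
open import Data.Nat.Tactic.RingSolver using (solve-∀)
open import Data.Bool using (Bool; true; false; not; _∧_; if_then_else_; T)
open import Data.Bool.Properties using (∧-identityʳ; ∧-assoc; ∧-conicalˡ; ∧-conicalʳ; ∧-commutativeMonoid)
open import Data.Fin using (zero; suc; toℕ)
open import Data.Fin.Properties using (_≟_; toℕ<n; toℕ-injective)
open import Data.Product using (proj₁; proj₂)
open import Data.Sum using (inj₁; inj₂)
open import Data.Unit using (tt)
open import Data.Vec using (Vec; []; _∷_; _++_)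
open import Algebra.Bundles using (CommutativeMonoid)
open import Algebra.Properties.CommutativeSemigroup (CommutativeMonoid.commutativeSemigroup ∧-commutativeMonoid)
  using () renaming (interchange to ∧-interchange; x∙yz≈y∙xz to ∧-swapˡ; xy∙z≈xz∙y to ∧-swapʳ)
open import Algebra.Properties.CommutativeSemigroup +-commutativeSemigroup
  using () renaming (interchange to +-interchange)
open import Algebra.Properties.CommutativeSemigroup *-commutativeSemigroup
  using () renaming (interchange to *-interchange; x∙yz≈y∙xz to *-swapˡ)
open import Function using (_∘_)
open import Function.Definitions using (Injective)
open import Relation.Binary.Definitions using (tri<; tri≈; tri>)
open import Relation.Binary.PropositionalEquality
open import Relation.Nullary using (does; yes; no; contradiction)

⟦_⟧ : Bool → ℕ
⟦ b ⟧ = if b then 1 else 0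

⟦∧⟧≡* : ∀ a b → ⟦ a ∧ b ⟧ ≡ ⟦ a ⟧ * ⟦ b ⟧
⟦∧⟧≡* true  b = sym (+-identityʳ ⟦ b ⟧)
⟦∧⟧≡* false b = refl

⟦⟧>0⇒≡true : ∀ {b} → 0 < ⟦ b ⟧ → b ≡ true
⟦⟧>0⇒≡true {true} _ = refl

∧-intro : ∀ {a b} → a ≡ true → b ≡ true → a ∧ b ≡ true
∧-intro refl refl = refl

not≡true⇒≡false : ∀ {b} → not b ≡ true → b ≡ false
not≡true⇒≡false {false} _ = refl

true≢false : true ≢ false
true≢false ()

<ᵇ≡true⇒< : ∀ {m n} → (m <ᵇ n) ≡ true → m < n
<ᵇ≡true⇒< {m} {n} m<ᵇn = <ᵇ⇒< m n (subst T (sym m<ᵇn) tt)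

<ᵇ≡false⇒≥ : ∀ {m n} → (m <ᵇ n) ≡ false → n ≤ m
<ᵇ≡false⇒≥ m≮ᵇn = ≮⇒≥ (λ m<n → subst T m≮ᵇn (<⇒<ᵇ m<n))

sum-cong : ∀ n {f g : Fin n → ℕ} → f ≗ g → sumFin n f ≡ sumFin n g
sum-cong zero    f≗g = refl
sum-cong (suc n) f≗g = cong₂ _+_ (f≗g zero) (sum-cong n (f≗g ∘ suc))

sum-mono-≤ : ∀ n {f g : Fin n → ℕ} → (∀ i → f i ≤ g i) → sumFin n f ≤ sumFin n g
sum-mono-≤ zero    f≤g = z≤n
sum-mono-≤ (suc n) f≤g = +-mono-≤ (f≤g zero) (sum-mono-≤ n (f≤g ∘ suc))

sum-distrib-+ : ∀ n (f g : Fin n → ℕ) → sumFin n (λ i → f i + g i) ≡ sumFin n f + sumFin n g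
sum-distrib-+ zero    f g = refl
sum-distrib-+ (suc n) f g = begin
  (f zero + g zero) + sumFin n (λ i → f (suc i) + g (suc i))
    ≡⟨ cong ((f zero + g zero) +_) (sum-distrib-+ n (f ∘ suc) (g ∘ suc)) ⟩
  (f zero + g zero) + (sumFin n (f ∘ suc) + sumFin n (g ∘ suc))
    ≡⟨ +-interchange (f zero) (g zero) _ _ ⟩
  (f zero + sumFin n (f ∘ suc)) + (g zero + sumFin n (g ∘ suc)) ∎
  where open ≡-Reasoning

*-distribˡ-sum : ∀ n c (f : Fin n → ℕ) → sumFin n (λ i → c * f i) ≡ c * sumFin n f
*-distribˡ-sum zero    c f = sym (*-zeroʳ c)
*-distribˡ-sum (suc n) c f =
  trans (cong (c * f zero +_) (*-distribˡ-sum n c (f ∘ suc))) (sym (*-distribˡ-+ c (f zero) _))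

*-distribʳ-sum : ∀ n c (f : Fin n → ℕ) → sumFin n (λ i → f i * c) ≡ sumFin n f * c
*-distribʳ-sum n c f =
  trans (sum-cong n (λ i → *-comm (f i) c)) (trans (*-distribˡ-sum n c f) (*-comm c _))

sum-const : ∀ n c → sumFin n (λ _ → c) ≡ n * c
sum-const zero    c = refl
sum-const (suc n) c = cong (c +_) (sum-const n c)

sum-comm : ∀ n m (f : Fin n → Fin m → ℕ) →
  sumFin n (λ i → sumFin m (f i)) ≡ sumFin m (λ j → sumFin n (λ i → f i j))
sum-comm zero    m f = sym (trans (sum-const m 0) (*-zeroʳ m))
sum-comm (suc n) m f =
  trans (cong (sumFin m (f zero) +_) (sum-comm n m (f ∘ suc)))
        (sym (sum-distrib-+ m (f zero) (λ j → sumFin n (λ i → f (suc i) j))))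

sum² : ∀ n → (Fin n → Fin n → ℕ) → ℕ
sum² n h = sumFin n (λ i → sumFin n (h i))

sum²-distrib-+ : ∀ n (h h′ : Fin n → Fin n → ℕ) → sum² n (λ i j → h i j + h′ i j) ≡ sum² n h + sum² n h′
sum²-distrib-+ n h h′ = trans (sum-cong n (λ i → sum-distrib-+ n (h i) (h′ i))) (sum-distrib-+ n _ _)

sum>0⇒∃ : ∀ n (f : Fin n → ℕ) → 0 < sumFin n f → ∃ λ i → 0 < f i
sum>0⇒∃ (suc n) f sum>0 with f zero in f0≡
... | suc _ = zero , subst (0 <_) (sym f0≡) z<s
... | zero  with sum>0⇒∃ n (f ∘ suc) sum>0
...   | i , fi>0 = suc i , fi>0

rearrangement : ∀ {a a′ b b′} → a ≤ a′ → b ≤ b′ → a * b′ + a′ * b ≤ a * b + a′ * b′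
rearrangement {a} {b = b} a≤a′ b≤b′ with m≤n⇒∃[o]m+o≡n a≤a′ | m≤n⇒∃[o]m+o≡n b≤b′
... | x , refl | y , refl =
  subst₂ _≤_ (sym (lhs a b x y)) (sym (rhs a b x y)) (m≤m+n _ (x * y))
  where
  lhs : ∀ a b x y → a * (b + y) + (a + x) * b ≡ a * b + a * b + a * y + x * b
  lhs = solve-∀
  rhs : ∀ a b x y → a * b + (a + x) * (b + y) ≡ a * b + a * b + a * y + x * b + x * y
  rhs = solve-∀

chebyshev-sum : ∀ n (f g : Fin n → ℕ) → (∀ i j → f i ≤ f j → g i ≤ g j) →
  sumFin n f * sumFin n g ≤ n * sumFin n (λ i → f i * g i)
chebyshev-sum n f g similarlyOrdered = *-cancelˡ-≤ 2 (begin
  2 * (F * G)                                              ≡⟨ two* (F * G) ⟩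
  F * G + F * G                                            ≡⟨ cong₂ _+_ (sym Σ²fᵢgⱼ) (sym Σ²fⱼgᵢ) ⟩
  Σ² (λ i j → f i * g j) + Σ² (λ i j → f j * g i)           ≡⟨ sym (sum²-distrib-+ n _ _) ⟩
  Σ² (λ i j → f i * g j + f j * g i)                        ≤⟨ sum-mono-≤ n (λ i → sum-mono-≤ n (pairwise i)) ⟩
  Σ² (λ i j → f i * g i + f j * g j)                        ≡⟨ sum²-distrib-+ n _ _ ⟩
  Σ² (λ i j → f i * g i) + Σ² (λ i j → f j * g j)           ≡⟨ cong₂ _+_ Σ²fᵢgᵢ (sum-const n H) ⟩
  n * H + n * H                                            ≡⟨ sym (two* (n * H)) ⟩
  2 * (n * H)                                              ∎)
  where
  open ≤-Reasoning
  F G H : ℕ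
  F = sumFin n f
  G = sumFin n g
  H = sumFin n (λ i → f i * g i)
  Σ² : (Fin n → Fin n → ℕ) → ℕ
  Σ² = sum² n
  two* : ∀ a → 2 * a ≡ a + a
  two* = solve-∀
  Σ²fᵢgⱼ : Σ² (λ i j → f i * g j) ≡ F * G
  Σ²fᵢgⱼ = trans (sum-cong n (λ i → *-distribˡ-sum n (f i) g)) (*-distribʳ-sum n G f)
  Σ²fⱼgᵢ : Σ² (λ i j → f j * g i) ≡ F * G
  Σ²fⱼgᵢ = trans (sum-cong n (λ i → *-distribʳ-sum n (g i) f)) (*-distribˡ-sum n F g)
  Σ²fᵢgᵢ : Σ² (λ i j → f i * g i) ≡ n * H
  Σ²fᵢgᵢ = trans (sum-cong n (λ i → sum-const n (f i * g i))) (*-distribˡ-sum n n _)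
  pairwise : ∀ i j → f i * g j + f j * g i ≤ f i * g i + f j * g j
  pairwise i j with ≤-total (f i) (f j)
  ... | inj₁ fi≤fj = rearrangement fi≤fj (similarlyOrdered i j fi≤fj)
  ... | inj₂ fj≤fi = subst₂ _≤_ (+-comm (f j * g i) _) (+-comm (f j * g j) _)
                       (rearrangement fj≤fi (similarlyOrdered j i fj≤fi))

power-mean : ∀ n r (f : Fin n → ℕ) →
  sumFin n f ^ suc r ≤ n ^ r * sumFin n (λ i → f i ^ suc r)
power-mean n zero    f = ≤-reflexive (trans (*-identityʳ (sumFin n f))
  (trans (sum-cong n (λ i → sym (*-identityʳ (f i)))) (sym (*-identityˡ _))))
power-mean n (suc r) f = begin
  F * F ^ suc r                                     ≤⟨ *-monoʳ-≤ F (power-mean n r f) ⟩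
  F * (n ^ r * sumFin n (λ i → f i ^ suc r))        ≡⟨ *-swapˡ F (n ^ r) _ ⟩
  n ^ r * (F * sumFin n (λ i → f i ^ suc r))        ≤⟨ *-monoʳ-≤ (n ^ r) (chebyshev-sum n f (λ i → f i ^ suc r)
                                                         (λ i j → ^-monoˡ-≤ (suc r))) ⟩
  n ^ r * (n * sumFin n (λ i → f i ^ suc (suc r)))  ≡⟨ swap-assoc (n ^ r) n _ ⟩
  n * n ^ r * sumFin n (λ i → f i ^ suc (suc r))    ∎
  where
  open ≤-Reasoning
  F : ℕ
  F = sumFin n f
  swap-assoc : ∀ a b c → a * (b * c) ≡ b * a * c
  swap-assoc = solve-∀

^-distribʳ-* : ∀ a b r → (a * b) ^ r ≡ a ^ r * b ^ r
^-distribʳ-* a b zero    = refl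
^-distribʳ-* a b (suc r) = trans (cong (a * b *_) (^-distribʳ-* a b r)) (*-interchange a b (a ^ r) (b ^ r))

sumVec : ∀ {n} m → (Vec (Fin n) m → ℕ) → ℕ
sumVec     zero    f = f []
sumVec {n} (suc m) f = sumFin n (λ v → sumVec m (f ∘ (v ∷_)))

sumVec-cong : ∀ {n} m {f g : Vec (Fin n) m → ℕ} → f ≗ g → sumVec m f ≡ sumVec m g
sumVec-cong     zero    f≗g = f≗g []
sumVec-cong {n} (suc m) f≗g = sum-cong n (λ v → sumVec-cong m (f≗g ∘ (v ∷_)))

sumVec-mono-≤ : ∀ {n} m {f g : Vec (Fin n) m → ℕ} → (∀ A → f A ≤ g A) → sumVec m f ≤ sumVec m g
sumVec-mono-≤     zero    f≤g = f≤g []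
sumVec-mono-≤ {n} (suc m) f≤g = sum-mono-≤ n (λ v → sumVec-mono-≤ m (f≤g ∘ (v ∷_)))

sumVec-distrib-+ : ∀ {n} m (f g : Vec (Fin n) m → ℕ) →
  sumVec m (λ A → f A + g A) ≡ sumVec m f + sumVec m g
sumVec-distrib-+     zero    f g = refl
sumVec-distrib-+ {n} (suc m) f g =
  trans (sum-cong n (λ v → sumVec-distrib-+ m (f ∘ (v ∷_)) (g ∘ (v ∷_)))) (sum-distrib-+ n _ _)

*-distribˡ-sumVec : ∀ {n} m c (f : Vec (Fin n) m → ℕ) → sumVec m (λ A → c * f A) ≡ c * sumVec m f
*-distribˡ-sumVec     zero    c f = refl
*-distribˡ-sumVec {n} (suc m) c f =
  trans (sum-cong n (λ v → *-distribˡ-sumVec m c (f ∘ (v ∷_)))) (*-distribˡ-sum n c _)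

sumVec-const : ∀ {n} m c → sumVec {n} m (λ _ → c) ≡ n ^ m * c
sumVec-const     zero    c = sym (*-identityˡ c)
sumVec-const {n} (suc m) c =
  trans (sum-cong n (λ v → sumVec-const m c)) (trans (sum-const n _) (sym (*-assoc n _ c)))

sumVec-sum-comm : ∀ {n k} m (f : Vec (Fin n) m → Fin k → ℕ) →
  sumVec m (λ A → sumFin k (f A)) ≡ sumFin k (λ y → sumVec m (λ A → f A y))
sumVec-sum-comm         zero    f = refl
sumVec-sum-comm {n} {k} (suc m) f =
  trans (sum-cong n (λ v → sumVec-sum-comm m (f ∘ (v ∷_))))
        (sum-comm n k (λ v y → sumVec m (λ A → f (v ∷ A) y)))

sumVec-comm : ∀ {n} m p (f : Vec (Fin n) m → Vec (Fin n) p → ℕ) →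
  sumVec m (λ A → sumVec p (f A)) ≡ sumVec p (λ B → sumVec m (λ A → f A B))
sumVec-comm     zero    p f = refl
sumVec-comm {n} (suc m) p f =
  trans (sum-cong n (λ v → sumVec-comm m p (f ∘ (v ∷_))))
        (sym (sumVec-sum-comm p (λ B v → sumVec m (λ A → f (v ∷ A) B))))

sumVec>0⇒∃ : ∀ {n} m (f : Vec (Fin n) m → ℕ) → 0 < sumVec m f → ∃ λ A → 0 < f A
sumVec>0⇒∃     zero    f sum>0 = [] , sum>0
sumVec>0⇒∃ {n} (suc m) f sum>0 with sum>0⇒∃ n _ sum>0
... | v , sumv>0 with sumVec>0⇒∃ m (f ∘ (v ∷_)) sumv>0
...   | A , fA>0 = v ∷ A , fA>0

power-mean-sumVec : ∀ n m r (f : Vec (Fin n) m → ℕ) →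
  sumVec m f ^ suc r ≤ (n ^ m) ^ r * sumVec m (λ A → f A ^ suc r)
power-mean-sumVec n zero    r f rewrite ^-zeroˡ r = ≤-reflexive (sym (*-identityˡ _))
power-mean-sumVec n (suc m) r f = begin
  sumFin n g ^ suc r                                          ≤⟨ power-mean n r g ⟩
  n ^ r * sumFin n (λ v → g v ^ suc r)                        ≤⟨ *-monoʳ-≤ (n ^ r) (sum-mono-≤ n
                                                                  (λ v → power-mean-sumVec n m r (f ∘ (v ∷_)))) ⟩
  n ^ r * sumFin n (λ v → (n ^ m) ^ r * sumVec m (λ A → f (v ∷ A) ^ suc r))
                                                              ≡⟨ cong (n ^ r *_) (*-distribˡ-sum n ((n ^ m) ^ r) _) ⟩
  n ^ r * ((n ^ m) ^ r * sumVec (suc m) (λ A → f A ^ suc r))  ≡⟨ sym (*-assoc (n ^ r) _ _) ⟩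
  n ^ r * (n ^ m) ^ r * sumVec (suc m) (λ A → f A ^ suc r)    ≡⟨ cong (_* sumVec (suc m) (λ A → f A ^ suc r))
                                                                   (sym (^-distribʳ-* n (n ^ m) r)) ⟩
  (n * n ^ m) ^ r * sumVec (suc m) (λ A → f A ^ suc r)        ∎
  where
  open ≤-Reasoning
  g : Fin n → ℕ
  g v = sumVec m (f ∘ (v ∷_))

m^[1+r]+n≤[m+n]^[1+r] : ∀ m n r → m ^ suc r + n ≤ (m + n) ^ suc r
m^[1+r]+n≤[m+n]^[1+r] m zero    r =
  ≤-reflexive (trans (+-identityʳ _) (cong (_^ suc r) (sym (+-identityʳ m))))
m^[1+r]+n≤[m+n]^[1+r] m n@(suc _) r = begin
  m * m ^ r + n                 ≤⟨ +-mono-≤ (*-monoʳ-≤ m (^-monoˡ-≤ r (m≤m+n m n)))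
                                            (m≤m*n n ((m + n) ^ r) {{ m^n≢0 (m + n) r {{ >-nonZero m+n>0 }} }}) ⟩
  m * (m + n) ^ r + n * (m + n) ^ r ≡⟨ sym (*-distribʳ-+ ((m + n) ^ r) m n) ⟩
  (m + n) * (m + n) ^ r         ∎
  where
  open ≤-Reasoning
  m+n>0 : 0 < m + n
  m+n>0 = ≤-trans (s≤s z≤n) (m≤n+m n m)

-- From (K + cD)^(1+r) I^r M ≤ I^r (cG + I K^(1+r)) with I ≤ M: expand (K + cD)^(1+r) ≥ K^(1+r) + cD,
-- cancel I^r, and the K^(1+r) M terms absorb I K^(1+r).
linear-bound-from-power : ∀ r K {c D G I M} .{{_ : NonZero c}} .{{_ : NonZero I}} → I ≤ M →
  (K + c * D) ^ suc r * (I ^ r * M) ≤ I ^ r * (c * G + I * K ^ suc r) → D * M ≤ G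
linear-bound-from-power r K {c} {D} {G} {I} {M} I≤M hyp =
  *-cancelˡ-≤ c (+-cancelˡ-≤ (M * K ^ suc r) _ _ (begin
  M * K ^ suc r + c * (D * M)   ≡⟨ regroup M (K ^ suc r) c D ⟩
  (K ^ suc r + c * D) * M       ≤⟨ *-monoˡ-≤ M (m^[1+r]+n≤[m+n]^[1+r] K (c * D) r) ⟩
  (K + c * D) ^ suc r * M       ≤⟨ *-cancelˡ-≤ (I ^ r) {{m^n≢0 I r}}
                                     (≤-trans (≤-reflexive (*-swapˡ (I ^ r) ((K + c * D) ^ suc r) M)) hyp) ⟩
  c * G + I * K ^ suc r         ≤⟨ +-monoʳ-≤ (c * G) (*-monoˡ-≤ (K ^ suc r) I≤M) ⟩
  c * G + M * K ^ suc r         ≡⟨ +-comm (c * G) _ ⟩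
  M * K ^ suc r + c * G         ∎))
  where
  open ≤-Reasoning
  regroup : ∀ M k c D → M * k + c * (D * M) ≡ (k + c * D) * M
  regroup = solve-∀

remainder>0 : ∀ {T G B B′ M M′ N} → T ≤ G + B + B′ → 4 * B ≤ T + N * (4 * M) → 4 * B′ ≤ T + N * (4 * M′) →
  (2 * (M + M′) + 1) * N ≤ T → 0 < N → 0 < G
remainder>0 {G = suc _} _ _ _ _ _ = z<s
remainder>0 {T} {zero} {B} {B′} {M} {M′} {N} T≤B+B′ 4B≤ 4B′≤ T-large N>0 =
  contradiction (+-cancelˡ-≤ (4 * T) (2 * N) 0 (begin
    4 * T + 2 * N                         ≤⟨ +-monoˡ-≤ (2 * N) (*-monoʳ-≤ 4 T≤B+B′) ⟩
    4 * (B + B′) + 2 * N                  ≡⟨ cong (_+ 2 * N) (*-distribˡ-+ 4 B B′) ⟩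
    4 * B + 4 * B′ + 2 * N                ≤⟨ +-monoˡ-≤ (2 * N) (+-mono-≤ 4B≤ 4B′≤) ⟩
    T + N * (4 * M) + (T + N * (4 * M′)) + 2 * N ≡⟨ regroup T N M M′ ⟩
    2 * T + 2 * ((2 * (M + M′) + 1) * N)  ≤⟨ +-monoʳ-≤ (2 * T) (*-monoʳ-≤ 2 T-large) ⟩
    2 * T + 2 * T                         ≡⟨ 2T+2T T ⟩
    4 * T + 0                             ∎)) (<⇒≱ (*-monoʳ-< 2 N>0))
  where
  open ≤-Reasoning
  regroup : ∀ T N M M′ → T + N * (4 * M) + (T + N * (4 * M′)) + 2 * N ≡ 2 * T + 2 * ((2 * (M + M′) + 1) * N)
  regroup = solve-∀
  2T+2T : ∀ T → 2 * T + 2 * T ≡ 4 * T + 0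
  2T+2T = solve-∀

VSet : ℕ → Set
VSet n = Fin n → Bool

card : ∀ {n} → VSet n → ℕ
card {n} S = sumFin n (⟦_⟧ ∘ S)

_∩_ : ∀ {n} → VSet n → VSet n → VSet n
(S ∩ S′) v = S v ∧ S′ v

_⊆_ : ∀ {n} → VSet n → VSet n → Set
S ⊆ S′ = ∀ v → S v ≡ true → S′ v ≡ true

∩-⊆ˡ : ∀ {n} (S S′ : VSet n) → (S ∩ S′) ⊆ S
∩-⊆ˡ S S′ v = ∧-conicalˡ (S v) (S′ v)

∩-monoˡ-⊆ : ∀ {n} {S S′ : VSet n} (P : VSet n) → S ⊆ S′ → (S ∩ P) ⊆ (S′ ∩ P)
∩-monoˡ-⊆ {S = S} P S⊆S′ v Sv∧Pv =
  ∧-intro (S⊆S′ v (∧-conicalˡ (S v) (P v) Sv∧Pv)) (∧-conicalʳ (S v) (P v) Sv∧Pv)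

card-mono-⊆ : ∀ {n} {S S′ : VSet n} → S ⊆ S′ → card S ≤ card S′
card-mono-⊆ {n} {S} {S′} S⊆S′ = sum-mono-≤ n pointwise
  where
  pointwise : ∀ v → ⟦ S v ⟧ ≤ ⟦ S′ v ⟧
  pointwise v with S v in Sv
  ... | true  rewrite S⊆S′ v Sv = ≤-refl
  ... | false = z≤n

card-split : ∀ {n} (S P : VSet n) → card S ≡ card (λ v → S v ∧ not (P v)) + card (S ∩ P)
card-split {n} S P = trans (sum-cong n pointwise) (sum-distrib-+ n _ _)
  where
  pointwise : ∀ v → ⟦ S v ⟧ ≡ ⟦ S v ∧ not (P v) ⟧ + ⟦ S v ∧ P v ⟧
  pointwise v with S v | P v
  ... | true  | true  = refl
  ... | true  | false = refl
  ... | false | _     = refl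

sum-δ : ∀ n (u : Fin n) (f : Fin n → ℕ) → sumFin n (λ w → ⟦ does (u ≟ w) ⟧ * f w) ≡ f u
sum-δ (suc n) zero    f = begin
  f zero + 0 + sumFin n (λ _ → 0) ≡⟨ cong₂ _+_ (+-identityʳ (f zero)) (trans (sum-const n 0) (*-zeroʳ n)) ⟩
  f zero + 0                      ≡⟨ +-identityʳ (f zero) ⟩
  f zero                          ∎
  where open ≡-Reasoning
sum-δ (suc n) (suc u) f = sum-δ n u (f ∘ suc)

allIn : ∀ {n r} → VSet n → Vec (Fin n) r → Bool
allIn P []      = true
allIn P (v ∷ A) = P v ∧ allIn P A

allIn-const-true : ∀ {n r} (A : Vec (Fin n) r) → allIn (λ _ → true) A ≡ true
allIn-const-true []      = refl
allIn-const-true (_ ∷ A) = allIn-const-true A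

allIn-∩ : ∀ {n r} (P Q : VSet n) (A : Vec (Fin n) r) → allIn (P ∩ Q) A ≡ allIn P A ∧ allIn Q A
allIn-∩ P Q []      = refl
allIn-∩ P Q (v ∷ A) = trans (cong ((P v ∧ Q v) ∧_) (allIn-∩ P Q A)) (∧-interchange (P v) (Q v) _ _)

allIn-comm : ∀ {n r p} (E : Fin n → Fin n → Bool) (A : Vec (Fin n) r) (B : Vec (Fin n) p) →
  allIn (λ b → allIn (λ a → E a b) A) B ≡ allIn (λ a → allIn (E a) B) A
allIn-comm E []      B = allIn-const-true B
allIn-comm E (a ∷ A) B =
  trans (allIn-∩ (E a) (λ b → allIn (λ a′ → E a′ b) A) B) (cong (allIn (E a) B ∧_) (allIn-comm E A B))

nth : ∀ {n r} → Fin n → Vec (Fin n) r → ℕ → Fin n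
nth d []      i       = d
nth d (v ∷ A) zero    = v
nth d (v ∷ A) (suc i) = nth d A i

nth-++ˡ : ∀ {n r p} d (A : Vec (Fin n) r) (B : Vec (Fin n) p) {i} → i < r → nth d (A ++ B) i ≡ nth d A i
nth-++ˡ d (v ∷ A) B {zero}  _         = refl
nth-++ˡ d (v ∷ A) B {suc i} (s≤s i<r) = nth-++ˡ d A B i<r

allIn⇒nth : ∀ {n r} (P : VSet n) d (A : Vec (Fin n) r) {i} → allIn P A ≡ true → i < r → P (nth d A i) ≡ true
allIn⇒nth P d (v ∷ A) {zero}  all _         = ∧-conicalˡ (P v) _ all
allIn⇒nth P d (v ∷ A) {suc i} all (s≤s i<r) = allIn⇒nth P d A (∧-conicalʳ (P v) _ all) i<r

reverse : ∀ {n} → Tournament n → Tournament n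
reverse T = record
  { adj    = λ u v → adj T v u
  ; irrefl = irrefl T
  ; tourn  = λ u v u≢v → tourn T v u (u≢v ∘ sym)
  }

chainFactor : ℕ → ℕ
chainFactor zero    = 1
chainFactor (suc r) = 2 * 8 ^ r * chainFactor r

chainThreshold : ℕ → ℕ
chainThreshold zero    = 0
chainThreshold (suc r) = 8 * chainThreshold r + 8

m<[m/4]*4+4 : ∀ m → m < m / 4 * 4 + 4
m<[m/4]*4+4 m = begin-strict
  m                   ≡⟨ m≡m%n+[m/n]*n m 4 ⟩
  m % 4 + m / 4 * 4   <⟨ +-monoˡ-< (m / 4 * 4) (m%n<n m 4) ⟩
  4 + m / 4 * 4       ≡⟨ +-comm 4 _ ⟩
  m / 4 * 4 + 4       ∎
  where open ≤-Reasoning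

chainThreshold<[m/4] : ∀ {r m} → chainThreshold (suc r) ≤ m → chainThreshold r < m / 4
chainThreshold<[m/4] {r} {m} K≤m = begin-strict
  K                <⟨ n<1+n K ⟩
  suc K            ≡⟨ sym (m*n/n≡m (suc K) 4) ⟩
  suc K * 4 / 4    ≤⟨ /-monoˡ-≤ 4 (≤-trans [1+K]*4≤8*K+8 K≤m) ⟩
  m / 4            ∎
  where
  open ≤-Reasoning
  K : ℕ
  K = chainThreshold r
  [1+K]*4≤8*K+8 : suc K * 4 ≤ 8 * K + 8
  [1+K]*4≤8*K+8 = subst (_≤ 8 * K + 8) (4*K+4≡[1+K]*4 K) (+-mono-≤ (*-monoˡ-≤ K (m≤m+n 4 4)) (m≤m+n 4 4))
    where
    4*K+4≡[1+K]*4 : ∀ K → 4 * K + 4 ≡ suc K * 4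
    4*K+4≡[1+K]*4 = solve-∀

m≤8*[m/4] : ∀ {m} → 0 < m / 4 → m ≤ 8 * (m / 4)
m≤8*[m/4] {m} 0<q = begin
  m             ≤⟨ <⇒≤ (m<[m/4]*4+4 m) ⟩
  q * 4 + 4     ≤⟨ +-monoʳ-≤ (q * 4) (*-monoʳ-≤ 4 0<q) ⟩
  q * 4 + 4 * q ≡⟨ q*4+4*q≡8*q q ⟩
  8 * q         ∎
  where
  open ≤-Reasoning
  q : ℕ
  q = m / 4
  q*4+4*q≡8*q : ∀ q → q * 4 + 4 * q ≡ 8 * q
  q*4+4*q≡8*q = solve-∀

thinExcess : ℕ → ℕ → ℕ
thinExcess r L = 2 * L * (chainThreshold (suc r) + 8 * L * chainFactor (suc r)) ^ r

chainFactor>0 : ∀ r → 0 < chainFactor r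
chainFactor>0 zero    = z<s
chainFactor>0 (suc r) = *-mono-≤ (*-mono-≤ {1} {2} (s≤s z≤n) (m^n>0 8 r)) (chainFactor>0 r)

chainFactor≢0 : ∀ r → NonZero (chainFactor r)
chainFactor≢0 r = >-nonZero (chainFactor>0 r)

module Chains {n : ℕ} (T : Tournament n) where

  isChain : ∀ {r} → VSet n → Vec (Fin n) r → Bool
  isChain S []      = true
  isChain S (v ∷ A) = S v ∧ isChain (S ∩ adj T v) A

  extensions : ∀ {r} → VSet n → Vec (Fin n) r → VSet n
  extensions S []      = S
  extensions S (v ∷ A) = extensions (S ∩ adj T v) A

  isChain-cong : ∀ {r} {S S′ : VSet n} (A : Vec (Fin n) r) → S ≗ S′ → isChain S A ≡ isChain S′ A
  isChain-cong []      S≗S′ = refl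
  isChain-cong (v ∷ A) S≗S′ = cong₂ _∧_ (S≗S′ v) (isChain-cong A (λ w → cong (_∧ adj T v w) (S≗S′ w)))

  isChain-mono-⊆ : ∀ {r} {S S′ : VSet n} (A : Vec (Fin n) r) → S ⊆ S′ → isChain S A ≡ true → isChain S′ A ≡ true
  isChain-mono-⊆ []      S⊆S′ chain = refl
  isChain-mono-⊆ {S = S} (v ∷ A) S⊆S′ chain =
    ∧-intro (S⊆S′ v (∧-conicalˡ (S v) _ chain))
            (isChain-mono-⊆ A (∩-monoˡ-⊆ (adj T v) S⊆S′) (∧-conicalʳ (S v) _ chain))

  isChain-∩ : ∀ {r} (S P : VSet n) (A : Vec (Fin n) r) → isChain (S ∩ P) A ≡ isChain S A ∧ allIn P A
  isChain-∩ S P []      = refl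
  isChain-∩ S P (v ∷ A) =
    trans (cong ((S v ∧ P v) ∧_) (trans (isChain-cong A reorder) (isChain-∩ (S ∩ adj T v) P A)))
          (∧-interchange (S v) (P v) _ _)
    where
    reorder : ((S ∩ P) ∩ adj T v) ≗ ((S ∩ adj T v) ∩ P)
    reorder w = ∧-swapʳ (S w) (P w) (adj T v w)

  isChain-++ : ∀ {r p} (S : VSet n) (A : Vec (Fin n) r) (B : Vec (Fin n) p) →
    isChain S (A ++ B) ≡ isChain S A ∧ isChain (extensions S A) B
  isChain-++ S []      B = refl
  isChain-++ S (v ∷ A) B = trans (cong (S v ∧_) (isChain-++ (S ∩ adj T v) A B)) (sym (∧-assoc (S v) _ _))

  isChain⇒nth∈ : ∀ {r} (S : VSet n) d (A : Vec (Fin n) r) {i} → isChain S A ≡ true → i < r → S (nth d A i) ≡ true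
  isChain⇒nth∈ S d (v ∷ A) {zero}  chain _ = ∧-conicalˡ (S v) _ chain
  isChain⇒nth∈ S d (v ∷ A) {suc i} chain (s≤s i<r) =
    ∩-⊆ˡ S (adj T v) _ (isChain⇒nth∈ (S ∩ adj T v) d A (∧-conicalʳ (S v) _ chain) i<r)

  isChain⇒adj : ∀ {r} (S : VSet n) d (A : Vec (Fin n) r) {i j} → isChain S A ≡ true → i < j → j < r →
    adj T (nth d A i) (nth d A j) ≡ true
  isChain⇒adj S d (v ∷ A) {zero}  {suc j} chain _ (s≤s j<r) =
    ∧-conicalʳ (S _) _ (isChain⇒nth∈ (S ∩ adj T v) d A (∧-conicalʳ (S v) _ chain) j<r)
  isChain⇒adj S d (v ∷ A) {suc i} {suc j} chain (s≤s i<j) (s≤s j<r) =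
    isChain⇒adj (S ∩ adj T v) d A (∧-conicalʳ (S v) _ chain) i<j j<r

  #chains : VSet n → ℕ → ℕ
  #chains S r = sumVec r (⟦_⟧ ∘ isChain S)

  #thinChains : VSet n → ℕ → ℕ → ℕ
  #thinChains S r L = sumVec r (λ A → ⟦ isChain S A ∧ (card (extensions S A) <ᵇ L) ⟧)

  #chains-suc : ∀ (S : VSet n) r → #chains S (suc r) ≡ sumFin n (λ v → ⟦ S v ⟧ * #chains (S ∩ adj T v) r)
  #chains-suc S r = sum-cong n (λ v →
    trans (sumVec-cong r (λ A → ⟦∧⟧≡* (S v) _)) (*-distribˡ-sumVec r ⟦ S v ⟧ _))

  #thinChains-suc : ∀ (S : VSet n) r L →
    #thinChains S (suc r) L ≡ sumFin n (λ v → ⟦ S v ⟧ * #thinChains (S ∩ adj T v) r L)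
  #thinChains-suc S r L = sum-cong n (λ v →
    trans (sumVec-cong r (λ A → trans (cong ⟦_⟧ (∧-assoc (S v) _ _)) (⟦∧⟧≡* (S v) _)))
          (*-distribˡ-sumVec r ⟦ S v ⟧ _))

  ⟦adj⟧+⟦adj⟧+⟦≟⟧≡1 : ∀ u w → ⟦ adj T u w ⟧ + ⟦ adj T w u ⟧ + ⟦ does (u ≟ w) ⟧ ≡ 1
  ⟦adj⟧+⟦adj⟧+⟦≟⟧≡1 u w with u ≟ w
  ... | yes refl rewrite irrefl T u = refl
  ... | no u≢w rewrite tourn T u w u≢w with adj T w u
  ...   | true  = refl
  ...   | false = refl

  innerEdges : VSet n → ℕ
  innerEdges Q = sumFin n (λ u → ⟦ Q u ⟧ * card (Q ∩ adj T u))

  card*card≡innerEdges+innerEdges+card : ∀ Q → card Q * card Q ≡ innerEdges Q + innerEdges Q + card Q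
  card*card≡innerEdges+innerEdges+card Q = begin
    card Q * card Q                         ≡⟨ sym (*-distribʳ-sum n (card Q) _) ⟩
    sumFin n (λ u → ⟦ Q u ⟧ * card Q)        ≡⟨ sum-cong n (λ u → sym (*-distribˡ-sum n ⟦ Q u ⟧ _)) ⟩
    Σ² (λ u w → ⟦ Q u ⟧ * ⟦ Q w ⟧)            ≡⟨ sum-cong n (λ u → sum-cong n (split u)) ⟩
    Σ² (λ u w → out u w + in′ u w + diag u w) ≡⟨ sum²-distrib-+ n _ _ ⟩
    Σ² (λ u w → out u w + in′ u w) + Σ² diag  ≡⟨ cong (_+ Σ² diag) (sum²-distrib-+ n out in′) ⟩
    Σ² out + Σ² in′ + Σ² diag                 ≡⟨ cong₂ _+_ (cong₂ _+_ Σ²out Σ²in) Σ²diag ⟩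
    innerEdges Q + innerEdges Q + card Q      ∎
    where
    open ≡-Reasoning
    Σ² : (Fin n → Fin n → ℕ) → ℕ
    Σ² = sum² n
    out in′ diag : Fin n → Fin n → ℕ
    out  u w = ⟦ Q u ⟧ * (⟦ Q w ⟧ * ⟦ adj T u w ⟧)
    in′  u w = ⟦ Q u ⟧ * (⟦ Q w ⟧ * ⟦ adj T w u ⟧)
    diag u w = ⟦ Q u ⟧ * (⟦ does (u ≟ w) ⟧ * ⟦ Q w ⟧)
    factor : ∀ x y a b c → x * (y * a) + x * (y * b) + x * (c * y) ≡ x * y * (a + b + c)
    factor = solve-∀
    split : ∀ u w → ⟦ Q u ⟧ * ⟦ Q w ⟧ ≡ out u w + in′ u w + diag u w
    split u w = sym (trans (factor ⟦ Q u ⟧ ⟦ Q w ⟧ _ _ _)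
                     (trans (cong (⟦ Q u ⟧ * ⟦ Q w ⟧ *_) (⟦adj⟧+⟦adj⟧+⟦≟⟧≡1 u w)) (*-identityʳ _)))
    Σ²out : Σ² out ≡ innerEdges Q
    Σ²out = sum-cong n (λ u → trans (*-distribˡ-sum n ⟦ Q u ⟧ _)
                                    (cong (⟦ Q u ⟧ *_) (sum-cong n (λ w → sym (⟦∧⟧≡* (Q w) (adj T u w))))))
    Σ²in : Σ² in′ ≡ innerEdges Q
    Σ²in = trans (sum-comm n n in′)
                 (trans (sum-cong n (λ w → sum-cong n (λ u → *-swapˡ ⟦ Q u ⟧ ⟦ Q w ⟧ _))) Σ²out)
    idem : ∀ b → ⟦ b ⟧ * ⟦ b ⟧ ≡ ⟦ b ⟧
    idem true  = refl
    idem false = refl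
    Σ²diag : Σ² diag ≡ card Q
    Σ²diag = sum-cong n (λ u → trans (*-distribˡ-sum n ⟦ Q u ⟧ _)
                                     (trans (cong (⟦ Q u ⟧ *_) (sum-δ n u (⟦_⟧ ∘ Q))) (idem (Q u))))

  lowOut : VSet n → ℕ → VSet n
  lowOut S L v = S v ∧ (card (S ∩ adj T v) <ᵇ L)

  -- Q = lowOut S L spans q(q-1)/2 edges, yet each vertex has fewer than L out-neighbours in Q.
  card-lowOut≤2*L : ∀ S L → card (lowOut S L) ≤ 2 * L
  card-lowOut≤2*L S L = cancel q (begin
    q * (q + 1)                 ≡⟨ sym (q*q+q (card Q)) ⟩
    q * q + q                   ≡⟨ cong (_+ q) (card*card≡innerEdges+innerEdges+card Q) ⟩
    innerEdges Q + innerEdges Q + q + q ≡⟨ double (innerEdges Q) q ⟩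
    2 * (innerEdges Q + q)      ≤⟨ *-monoʳ-≤ 2 innerEdges+q≤q*L ⟩
    2 * (q * L)                 ≡⟨ *-swapˡ 2 q L ⟩
    q * (2 * L)                 ∎)
    where
    open ≤-Reasoning
    Q : VSet n
    Q = lowOut S L
    q : ℕ
    q = card Q
    q*q+q : ∀ q → q * q + q ≡ q * (q + 1)
    q*q+q = solve-∀
    double : ∀ d q → d + d + q + q ≡ 2 * (d + q)
    double = solve-∀
    cancel : ∀ q {m} → q * (q + 1) ≤ q * m → q ≤ m
    cancel zero        _      = z≤n
    cancel q@(suc _) q*q+1≤q*m = ≤-trans (m≤m+n q 1) (*-cancelˡ-≤ q q*q+1≤q*m)
    perVertex : ∀ u → ⟦ Q u ⟧ * (card (Q ∩ adj T u) + 1) ≤ ⟦ Q u ⟧ * L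
    perVertex u with Q u in Qu
    ... | false = z≤n
    ... | true  = +-monoˡ-≤ 0 (begin
      card (Q ∩ adj T u) + 1  ≤⟨ +-monoˡ-≤ 1 (card-mono-⊆ (∩-monoˡ-⊆ (adj T u) (∩-⊆ˡ S _))) ⟩
      card (S ∩ adj T u) + 1  ≡⟨ +-comm _ 1 ⟩
      suc (card (S ∩ adj T u)) ≤⟨ <ᵇ≡true⇒< (∧-conicalʳ (S u) _ Qu) ⟩
      L                       ∎)
    innerEdges+q≤q*L : innerEdges Q + q ≤ q * L
    innerEdges+q≤q*L = begin
      innerEdges Q + q ≡⟨ sym (sum-distrib-+ n _ _) ⟩
      sumFin n (λ u → ⟦ Q u ⟧ * card (Q ∩ adj T u) + ⟦ Q u ⟧)
        ≡⟨ sum-cong n (λ u → trans (cong (⟦ Q u ⟧ * card (Q ∩ adj T u) +_) (sym (*-identityʳ ⟦ Q u ⟧)))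
                                   (sym (*-distribˡ-+ ⟦ Q u ⟧ _ 1))) ⟩
      sumFin n (λ u → ⟦ Q u ⟧ * (card (Q ∩ adj T u) + 1)) ≤⟨ sum-mono-≤ n perVertex ⟩
      sumFin n (λ u → ⟦ Q u ⟧ * L)                       ≡⟨ *-distribʳ-sum n L _ ⟩
      q * L ∎

  highOut : VSet n → ℕ → VSet n
  highOut S L v = S v ∧ not (card (S ∩ adj T v) <ᵇ L)

  card≤2*card-highOut : ∀ (S : VSet n) → card S ≤ 2 * card (highOut S (card S / 4))
  card≤2*card-highOut S = +-cancelʳ-≤ s s (2 * h) (begin
    s + s                      ≤⟨ +-mono-≤ s≤h+2*q s≤h+2*q ⟩
    (h + 2 * q) + (h + 2 * q)  ≡⟨ regroup h q ⟩
    2 * h + q * 4              ≤⟨ +-monoʳ-≤ (2 * h) (m/n*n≤m s 4) ⟩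
    2 * h + s                  ∎)
    where
    open ≤-Reasoning
    s q h : ℕ
    s = card S
    q = s / 4
    h = card (highOut S q)
    regroup : ∀ h q → (h + 2 * q) + (h + 2 * q) ≡ 2 * h + q * 4
    regroup = solve-∀
    s≤h+2*q : s ≤ h + 2 * q
    s≤h+2*q = begin
      s                        ≡⟨ card-split S (λ v → card (S ∩ adj T v) <ᵇ q) ⟩
      h + card (lowOut S q)    ≤⟨ +-monoʳ-≤ h (card-lowOut≤2*L S q) ⟩
      h + 2 * q                ∎

  -- With q = ⌊s/4⌋, at least s/2 vertices of S have q or more out-neighbours in S; each starts
  -- at least q^r / chainFactor r chains by induction, and s ≤ 8q.
  card^≤chainFactor*#chains : ∀ r (S : VSet n) → chainThreshold r ≤ card S →
    card S ^ r ≤ chainFactor r * #chains S r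
  card^≤chainFactor*#chains zero    S _   = ≤-refl
  card^≤chainFactor*#chains (suc r) S K≤s = begin
    s * s ^ r                                  ≤⟨ *-mono-≤ (card≤2*card-highOut S) (^-monoˡ-≤ r (m≤8*[m/4] 0<q)) ⟩
    2 * h * (8 * q) ^ r                        ≡⟨ cong (2 * h *_) (^-distribʳ-* 8 q r) ⟩
    2 * h * (8 ^ r * q ^ r)                    ≡⟨ regroup h (8 ^ r) (q ^ r) ⟩
    2 * 8 ^ r * (h * q ^ r)                    ≤⟨ *-monoʳ-≤ (2 * 8 ^ r) h*q^r≤ ⟩
    2 * 8 ^ r * (chainFactor r * #chains S (suc r)) ≡⟨ sym (*-assoc (2 * 8 ^ r) _ _) ⟩
    chainFactor (suc r) * #chains S (suc r)    ∎
    where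
    open ≤-Reasoning
    s q h : ℕ
    s = card S
    q = s / 4
    h = card (highOut S q)
    regroup : ∀ a b c → 2 * a * (b * c) ≡ 2 * b * (a * c)
    regroup = solve-∀
    K<q : chainThreshold r < q
    K<q = chainThreshold<[m/4] {r} K≤s
    0<q : 0 < q
    0<q = ≤-<-trans z≤n K<q
    perVertex : ∀ v → ⟦ highOut S q v ⟧ * q ^ r ≤ ⟦ S v ⟧ * (chainFactor r * #chains (S ∩ adj T v) r)
    perVertex v with S v | card (S ∩ adj T v) <ᵇ q in lowv
    ... | false | _     = z≤n
    ... | true  | true  = z≤n
    ... | true  | false = +-monoˡ-≤ 0 (begin
      q ^ r                       ≤⟨ ^-monoˡ-≤ r q≤out ⟩
      card (S ∩ adj T v) ^ r      ≤⟨ card^≤chainFactor*#chains r (S ∩ adj T v) (≤-trans (<⇒≤ K<q) q≤out) ⟩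
      chainFactor r * #chains (S ∩ adj T v) r ∎)
      where
      q≤out : q ≤ card (S ∩ adj T v)
      q≤out = <ᵇ≡false⇒≥ lowv
    h*q^r≤ : h * q ^ r ≤ chainFactor r * #chains S (suc r)
    h*q^r≤ = begin
      h * q ^ r                            ≡⟨ sym (*-distribʳ-sum n (q ^ r) _) ⟩
      sumFin n (λ v → ⟦ highOut S q v ⟧ * q ^ r) ≤⟨ sum-mono-≤ n perVertex ⟩
      sumFin n (λ v → ⟦ S v ⟧ * (chainFactor r * #chains (S ∩ adj T v) r))
        ≡⟨ sum-cong n (λ v → *-swapˡ ⟦ S v ⟧ (chainFactor r) _) ⟩
      sumFin n (λ v → chainFactor r * (⟦ S v ⟧ * #chains (S ∩ adj T v) r))
        ≡⟨ *-distribˡ-sum n (chainFactor r) _ ⟩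
      chainFactor r * sumFin n (λ v → ⟦ S v ⟧ * #chains (S ∩ adj T v) r)
        ≡⟨ cong (chainFactor r *_) (sym (#chains-suc S r)) ⟩
      chainFactor r * #chains S (suc r)    ∎

  #thinChains≤2*L*card^ : ∀ r (S : VSet n) L → #thinChains S (suc r) L ≤ 2 * L * card S ^ r
  #thinChains≤2*L*card^ zero    S L = begin
    #thinChains S 1 L     ≡⟨ sum-cong n (λ v → cong (λ b → ⟦ b ∧ (card (S ∩ adj T v) <ᵇ L) ⟧)
                                                     (∧-identityʳ (S v))) ⟩
    card (lowOut S L)     ≤⟨ card-lowOut≤2*L S L ⟩
    2 * L                 ≡⟨ sym (*-identityʳ (2 * L)) ⟩
    2 * L * 1             ∎
    where open ≤-Reasoning
  #thinChains≤2*L*card^ (suc r) S L = begin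
    #thinChains S (suc (suc r)) L                          ≡⟨ #thinChains-suc S (suc r) L ⟩
    sumFin n (λ v → ⟦ S v ⟧ * #thinChains (S ∩ adj T v) (suc r) L) ≤⟨ sum-mono-≤ n perVertex ⟩
    sumFin n (λ v → ⟦ S v ⟧ * (2 * L * card S ^ r))         ≡⟨ *-distribʳ-sum n _ _ ⟩
    card S * (2 * L * card S ^ r)                          ≡⟨ *-swapˡ (card S) (2 * L) _ ⟩
    2 * L * (card S * card S ^ r)                          ∎
    where
    open ≤-Reasoning
    perVertex : ∀ v → ⟦ S v ⟧ * #thinChains (S ∩ adj T v) (suc r) L ≤ ⟦ S v ⟧ * (2 * L * card S ^ r)
    perVertex v = *-monoʳ-≤ ⟦ S v ⟧ (≤-trans (#thinChains≤2*L*card^ r (S ∩ adj T v) L)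
                    (*-monoʳ-≤ (2 * L) (^-monoˡ-≤ r (card-mono-⊆ (∩-⊆ˡ S (adj T v))))))

  card^≤chainFactor*#chains+threshold^ : ∀ r (S : VSet n) →
    card S ^ r ≤ chainFactor r * #chains S r + chainThreshold r ^ r
  card^≤chainFactor*#chains+threshold^ r S with chainThreshold r ≤? card S
  ... | yes K≤s = ≤-trans (card^≤chainFactor*#chains r S K≤s) (m≤m+n _ _)
  ... | no  K≰s = ≤-trans (^-monoˡ-≤ r (<⇒≤ (≰⇒> K≰s))) (m≤n+m _ _)

  chain-exists : ∀ r (S : VSet n) → chainThreshold r < card S → ∃ λ A → isChain S A ≡ true
  chain-exists r S K<s with sumVec>0⇒∃ r (⟦_⟧ ∘ isChain S) #chains>0
    where
    c*#chains>0 : 0 < chainFactor r * #chains S r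
    c*#chains>0 = ≤-trans (m^n>0 (card S) {{>-nonZero (≤-<-trans z≤n K<s)}} r)
                          (card^≤chainFactor*#chains r S (<⇒≤ K<s))
    #chains>0 : 0 < #chains S r
    #chains>0 = >-nonZero⁻¹ _ {{m*n≢0⇒n≢0 (chainFactor r) {{>-nonZero c*#chains>0}}}}
  ... | A , chain>0 = A , ⟦⟧>0⇒≡true chain>0

  -- On a set of size at least K₁ thin chains are at most a quarter of all chains; on a smaller
  -- set there are at most thinExcess r L of them.
  4*#thinChains≤#chains+4*thinExcess : ∀ r L (S : VSet n) →
    4 * #thinChains S (suc r) L ≤ #chains S (suc r) + 4 * thinExcess r L
  4*#thinChains≤#chains+4*thinExcess r L S with K₁ ≤? card S
    where
    K₁ : ℕ
    K₁ = chainThreshold (suc r) + 8 * L * chainFactor (suc r)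
  ... | yes K₁≤s = ≤-trans (*-cancelˡ-≤ c {{chainFactor≢0 (suc r)}} (begin
    c * (4 * #thinChains S (suc r) L)   ≤⟨ *-monoʳ-≤ c (*-monoʳ-≤ 4 (#thinChains≤2*L*card^ r S L)) ⟩
    c * (4 * (2 * L * s ^ r))           ≡⟨ regroup c L (s ^ r) ⟩
    8 * L * c * s ^ r                   ≤⟨ *-monoˡ-≤ (s ^ r) (≤-trans (m≤n+m _ (chainThreshold (suc r))) K₁≤s) ⟩
    s * s ^ r                           ≤⟨ card^≤chainFactor*#chains (suc r) S (≤-trans (m≤m+n _ _) K₁≤s) ⟩
    c * #chains S (suc r)               ∎)) (m≤m+n _ _)
    where
    open ≤-Reasoning
    c s : ℕ
    c = chainFactor (suc r)
    s = card S
    regroup : ∀ c L x → c * (4 * (2 * L * x)) ≡ 8 * L * c * x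
    regroup = solve-∀
  ... | no  K₁≰s = ≤-trans (*-monoʳ-≤ 4 (≤-trans (#thinChains≤2*L*card^ r S L)
                      (*-monoʳ-≤ (2 * L) (^-monoˡ-≤ r (<⇒≤ (≰⇒> K₁≰s))))))
                    (m≤n+m _ (#chains S (suc r)))

  weighted-#thinChains≤ : ∀ {p} r L (w : Vec (Fin n) p → Bool) (S : Vec (Fin n) p → VSet n) →
    4 * sumVec p (λ A → ⟦ w A ⟧ * #thinChains (S A) (suc r) L)
      ≤ sumVec p (λ A → ⟦ w A ⟧ * #chains (S A) (suc r)) + n ^ p * (4 * thinExcess r L)
  weighted-#thinChains≤ {p} r L w S = begin
    4 * sumVec p (λ A → ⟦ w A ⟧ * thin A)          ≡⟨ sym (*-distribˡ-sumVec p 4 _) ⟩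
    sumVec p (λ A → 4 * (⟦ w A ⟧ * thin A))        ≤⟨ sumVec-mono-≤ p (λ A → perTuple (w A) (S A)) ⟩
    sumVec p (λ A → ⟦ w A ⟧ * chains A + 4 * M)    ≡⟨ sumVec-distrib-+ p _ _ ⟩
    weighted + sumVec {n} p (λ _ → 4 * M)          ≡⟨ cong (weighted +_) (sumVec-const p (4 * M)) ⟩
    weighted + n ^ p * (4 * M)                     ∎
    where
    open ≤-Reasoning
    thin chains : Vec (Fin n) p → ℕ
    thin   A = #thinChains (S A) (suc r) L
    chains A = #chains (S A) (suc r)
    M weighted : ℕ
    M = thinExcess r L
    weighted = sumVec p (λ A → ⟦ w A ⟧ * chains A)
    perTuple : ∀ b S′ → 4 * (⟦ b ⟧ * #thinChains S′ (suc r) L) ≤ ⟦ b ⟧ * #chains S′ (suc r) + 4 * M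
    perTuple false S′ = z≤n
    perTuple true  S′ rewrite +-identityʳ (#thinChains S′ (suc r) L) | +-identityʳ (#chains S′ (suc r)) =
      4*#thinChains≤#chains+4*thinExcess r L S′

-- xs i is x_(k-i), the X-half listed backwards, and ys q is y_(q+1).
record SplitPathPower {n : ℕ} (T : Tournament n) (X : Part n) (k : ℕ) : Set where
  field
    xs ys     : ℕ → Fin n
    xs∈X      : ∀ {i} → i < k → X (xs i) ≡ true
    ys∉X      : ∀ {q} → q < k → X (ys q) ≡ false
    xs-adj    : ∀ {i j} → i < j → j < k → adj T (xs j) (xs i) ≡ true
    ys-adj    : ∀ {p q} → p < q → q < k → adj T (ys p) (ys q) ≡ true
    xs-ys-adj : ∀ {i q} → q + i < k → adj T (xs i) (ys q) ≡ true

k∸[1+p]<k : ∀ {k p} → p < k → k ∸ suc p < k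
k∸[1+p]<k p<k = ∸-monoʳ-< z<s p<k

q∸k<k : ∀ {k q} → k ≤ q → q < k + k → q ∸ k < k
q∸k<k {k} {q} k≤q q<k+k = subst (q ∸ k <_) (m+n∸n≡m k k) (∸-monoˡ-< q<k+k k≤q)

q∸k+[k∸[1+p]]<k : ∀ {k p q} → p < k → q ≤ p + k → q ∸ k + (k ∸ suc p) < k
q∸k+[k∸[1+p]]<k {k} {p} {q} p<k q≤p+k = begin-strict
  q ∸ k + (k ∸ suc p)        <⟨ +-monoˡ-< (k ∸ suc p) (s≤s q∸k≤p) ⟩
  suc p + (k ∸ suc p)        ≡⟨ m+[n∸m]≡n p<k ⟩
  k                          ∎
  where
  open ≤-Reasoning
  q∸k≤p : q ∸ k ≤ p
  q∸k≤p = subst (q ∸ k ≤_) (m+n∸n≡m p k) (∸-monoˡ-≤ k q≤p+k)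

module _ {n : ℕ} {T : Tournament n} {X : Part n} {k : ℕ} (P : SplitPathPower T X k) where
  open SplitPathPower P

  private
    seq : ℕ → Fin n
    seq p = if p <ᵇ k then xs (k ∸ suc p) else ys (p ∸ k)

    seq-< : ∀ {p} → p < k → seq p ≡ xs (k ∸ suc p)
    seq-< {p} p<k with p <ᵇ k in p<ᵇk
    ... | true  = refl
    ... | false = contradiction (<ᵇ≡false⇒≥ p<ᵇk) (<⇒≱ p<k)

    seq-≥ : ∀ {p} → k ≤ p → seq p ≡ ys (p ∸ k)
    seq-≥ {p} k≤p with p <ᵇ k in p<ᵇk
    ... | true  = contradiction k≤p (<⇒≱ (<ᵇ≡true⇒< p<ᵇk))
    ... | false = refl

    seq-adj : ∀ {p q} → p < q → q < k + k → q ≤ p + k → adj T (seq p) (seq q) ≡ true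
    seq-adj {p} {q} p<q q<2k q≤p+k with p <? k | q <? k
    ... | yes p<k | yes q<k rewrite seq-< p<k | seq-< q<k =
      xs-adj (∸-monoʳ-< (s≤s p<q) q<k) (k∸[1+p]<k p<k)
    ... | yes p<k | no  q≮k rewrite seq-< p<k | seq-≥ (≮⇒≥ q≮k) =
      xs-ys-adj (q∸k+[k∸[1+p]]<k p<k q≤p+k)
    ... | no  p≮k | yes q<k = contradiction (<-trans p<q q<k) p≮k
    ... | no  p≮k | no  q≮k rewrite seq-≥ (≮⇒≥ p≮k) | seq-≥ (≮⇒≥ q≮k) =
      ys-adj (∸-monoˡ-< p<q (≮⇒≥ p≮k)) (q∸k<k (≮⇒≥ q≮k) q<2k)

    u : Fin (k + k) → Fin n
    u i = seq (toℕ i)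

    u∈X : ∀ i → toℕ i < k → X (u i) ≡ true
    u∈X i i<k rewrite seq-< i<k = xs∈X (k∸[1+p]<k i<k)

    u∉X : ∀ i → k ≤ toℕ i → X (u i) ≡ false
    u∉X i k≤i rewrite seq-≥ k≤i = ys∉X (q∸k<k k≤i (toℕ<n i))

    u-pathPower : IsPathPower T k u
    u-pathPower i j i<j j≤i+k = seq-adj i<j (toℕ<n j) j≤i+k

    -- Entries at most k apart are joined by an edge, hence distinct; entries further apart
    -- lie on different sides of the partition.
    u-distinct : ∀ i j → toℕ i < toℕ j → u i ≢ u j
    u-distinct i j i<j ui≡uj with toℕ j ≤? toℕ i + k
    ... | yes j≤i+k = true≢false (trans (sym uj→uj) (irrefl T (u j)))
      where
      uj→uj : adj T (u j) (u j) ≡ true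
      uj→uj = trans (cong (λ v → adj T v (u j)) (sym ui≡uj)) (u-pathPower i j i<j j≤i+k)
    ... | no  j≰i+k = true≢false (trans (sym (u∈X i i<k)) (trans (cong X ui≡uj) (u∉X j k≤j)))
      where
      i+k<j : toℕ i + k < toℕ j
      i+k<j = ≰⇒> j≰i+k
      k≤j : k ≤ toℕ j
      k≤j = ≤-trans (m≤n+m k (toℕ i)) (<⇒≤ i+k<j)
      i<k : toℕ i < k
      i<k = +-cancelʳ-< k (toℕ i) k (<-trans i+k<j (toℕ<n j))

    u-injective : Injective _≡_ _≡_ u
    u-injective {i} {j} ui≡uj with <-cmp (toℕ i) (toℕ j)
    ... | tri< i<j _ _ = contradiction ui≡uj (u-distinct i j i<j)
    ... | tri≈ _ i≡j _ = toℕ-injective i≡j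
    ... | tri> _ _ j<i = contradiction (sym ui≡uj) (u-distinct j i j<i)

  toGoodSeq : ∃ λ (u : Fin (k + k) → Fin n) → GoodSeq T X k u
  toGoodSeq = u , u∈X , u∉X , u-injective , u-pathPower

-- Many edges give many stars (with D = starConstant), many stars give many pairs (with
-- Z = pairConstant), and pairConstant outweighs the pairs that are thin on either side.
pairConstant : ℕ → ℕ → ℕ
pairConstant m′ t′ =
  2 * (thinExcess t′ (suc (chainThreshold (suc m′))) + thinExcess m′ (suc (chainThreshold (suc t′)))) + 1

starConstant : ℕ → ℕ → ℕ
starConstant m′ t′ = chainThreshold (suc t′) + chainFactor (suc t′) * pairConstant m′ t′

edgeConstant : ℕ → ℕ → ℕ
edgeConstant m′ t′ = chainThreshold (suc m′) + chainFactor (suc m′) * starConstant m′ t′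

module CrossChains {n : ℕ} (T : Tournament n) (X : Part n) where

  -- X-chains live in the reversed tournament: a chain A lists x_k, x_(k-1), … backwards.
  module CX = Chains (reverse T)
  module CY = Chains T

  Y : VSet n
  Y v = not (X v)

  cross : Fin n → Fin n → Bool
  cross x y = X x ∧ not (X y) ∧ adj T x y

  cross⇒adj : ∀ {x y} → cross x y ≡ true → adj T x y ≡ true
  cross⇒adj {x} {y} x→y = ∧-conicalʳ (not (X y)) _ (∧-conicalʳ (X x) _ x→y)

  crossIn : Fin n → VSet n
  crossIn y x = cross x y

  commonOut : ∀ {r} → Vec (Fin n) r → VSet n
  commonOut A = Y ∩ (λ y → allIn (crossIn y) A)

  commonIn : ∀ {r} → Vec (Fin n) r → VSet n
  commonIn B = X ∩ (λ x → allIn (cross x) B)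

  isPair : ∀ {r p} → Vec (Fin n) r → Vec (Fin n) p → Bool
  isPair A B = CX.isChain X A ∧ CY.isChain (commonOut A) B

  isPair-sym : ∀ {r p} (A : Vec (Fin n) r) (B : Vec (Fin n) p) →
    isPair A B ≡ CY.isChain Y B ∧ CX.isChain (commonIn B) A
  isPair-sym A B = begin
    CX.isChain X A ∧ CY.isChain (commonOut A) B
      ≡⟨ cong (CX.isChain X A ∧_) (CY.isChain-∩ Y _ B) ⟩
    CX.isChain X A ∧ (CY.isChain Y B ∧ allIn (λ y → allIn (crossIn y) A) B)
      ≡⟨ cong (λ b → CX.isChain X A ∧ (CY.isChain Y B ∧ b)) (allIn-comm cross A B) ⟩
    CX.isChain X A ∧ (CY.isChain Y B ∧ allIn (λ x → allIn (cross x) B) A)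
      ≡⟨ ∧-swapˡ (CX.isChain X A) (CY.isChain Y B) _ ⟩
    CY.isChain Y B ∧ (CX.isChain X A ∧ allIn (λ x → allIn (cross x) B) A)
      ≡⟨ cong (CY.isChain Y B ∧_) (sym (CX.isChain-∩ X _ A)) ⟩
    CY.isChain Y B ∧ CX.isChain (commonIn B) A ∎
    where open ≡-Reasoning

  eXY≡Σ-card-crossIn : eXY T X ≡ sumFin n (card ∘ crossIn)
  eXY≡Σ-card-crossIn = sum-comm n n (λ x y → ⟦ cross x y ⟧)

  #stars : ℕ → ℕ
  #stars r = sumVec r (λ A → ⟦ CX.isChain X A ⟧ * card (commonOut A))

  -- For A ≠ [], y ∈ commonOut A already forces y ∈ Y, so the stars (A, y) can be counted from y.
  #stars≡Σ-#chains : ∀ r → #stars (suc r) ≡ sumFin n (λ y → CX.#chains (crossIn y) (suc r))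
  #stars≡Σ-#chains r = begin
    #stars (suc r)
      ≡⟨ sumVec-cong (suc r) (λ A → sym (*-distribˡ-sum n ⟦ CX.isChain X A ⟧ (⟦_⟧ ∘ commonOut A))) ⟩
    sumVec (suc r) (λ A → sumFin n (λ y → ⟦ CX.isChain X A ⟧ * ⟦ commonOut A y ⟧))
      ≡⟨ sumVec-sum-comm (suc r) (λ A y → ⟦ CX.isChain X A ⟧ * ⟦ commonOut A y ⟧) ⟩
    sumFin n (λ y → sumVec (suc r) (λ A → ⟦ CX.isChain X A ⟧ * ⟦ commonOut A y ⟧))
      ≡⟨ sum-cong n (λ y → sumVec-cong (suc r) (star y)) ⟩
    sumFin n (λ y → CX.#chains (crossIn y) (suc r)) ∎
    where
    open ≡-Reasoning
    crossIn⊆X : ∀ y → crossIn y ≗ X ∩ crossIn y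
    crossIn⊆X y x with X x
    ... | true  = refl
    ... | false = refl
    commonOut-∷ : ∀ {r} y a (A : Vec (Fin n) r) → commonOut (a ∷ A) y ≡ allIn (crossIn y) (a ∷ A)
    commonOut-∷ y a A with X y | X a
    ... | true  | true  = refl
    ... | true  | false = refl
    ... | false | _     = refl
    star : ∀ y (A : Vec (Fin n) (suc r)) → ⟦ CX.isChain X A ⟧ * ⟦ commonOut A y ⟧ ≡ ⟦ CX.isChain (crossIn y) A ⟧
    star y A@(a ∷ A′) = begin
      ⟦ CX.isChain X A ⟧ * ⟦ commonOut A y ⟧          ≡⟨ cong (λ b → ⟦ CX.isChain X A ⟧ * ⟦ b ⟧) (commonOut-∷ y a A′) ⟩
      ⟦ CX.isChain X A ⟧ * ⟦ allIn (crossIn y) A ⟧    ≡⟨ sym (⟦∧⟧≡* (CX.isChain X A) _) ⟩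
      ⟦ CX.isChain X A ∧ allIn (crossIn y) A ⟧        ≡⟨ cong ⟦_⟧ (sym (CX.isChain-∩ X (crossIn y) A)) ⟩
      ⟦ CX.isChain (X ∩ crossIn y) A ⟧                ≡⟨ cong ⟦_⟧ (CX.isChain-cong A (λ x → sym (crossIn⊆X y x))) ⟩
      ⟦ CX.isChain (crossIn y) A ⟧                    ∎

  #stars-bound : ∀ r D → 0 < n →
    (chainThreshold (suc r) + chainFactor (suc r) * D) ^ suc r * n ^ (r + suc r) ≤ eXY T X ^ suc r →
    D * n ^ suc r ≤ #stars (suc r)
  #stars-bound r D n>0 hyp =
    linear-bound-from-power r K {{chainFactor≢0 (suc r)}} {{>-nonZero n>0}} (m≤m*n n (n ^ r) {{m^n≢0 n r {{>-nonZero n>0}}}}) (begin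
      (K + c * D) ^ suc r * (n ^ r * n ^ suc r)   ≡⟨ cong ((K + c * D) ^ suc r *_) (sym (^-distribˡ-+-* n r (suc r))) ⟩
      (K + c * D) ^ suc r * n ^ (r + suc r)       ≤⟨ hyp ⟩
      eXY T X ^ suc r                             ≡⟨ cong (_^ suc r) eXY≡Σ-card-crossIn ⟩
      sumFin n (card ∘ crossIn) ^ suc r           ≤⟨ power-mean n r (card ∘ crossIn) ⟩
      n ^ r * sumFin n (λ y → card (crossIn y) ^ suc r) ≤⟨ *-monoʳ-≤ (n ^ r) Σ-card^≤ ⟩
      n ^ r * (c * #stars (suc r) + n * K ^ suc r) ∎)
    where
    open ≤-Reasoning
    K c : ℕ
    K = chainThreshold (suc r)
    c = chainFactor (suc r)
    Σ-card^≤ : sumFin n (λ y → card (crossIn y) ^ suc r) ≤ c * #stars (suc r) + n * K ^ suc r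
    Σ-card^≤ = begin
      sumFin n (λ y → card (crossIn y) ^ suc r)
        ≤⟨ sum-mono-≤ n (λ y → CX.card^≤chainFactor*#chains+threshold^ (suc r) (crossIn y)) ⟩
      sumFin n (λ y → c * CX.#chains (crossIn y) (suc r) + K ^ suc r)
        ≡⟨ sum-distrib-+ n _ _ ⟩
      sumFin n (λ y → c * CX.#chains (crossIn y) (suc r)) + sumFin n (λ _ → K ^ suc r)
        ≡⟨ cong₂ _+_ (*-distribˡ-sum n c _) (sum-const n _) ⟩
      c * sumFin n (λ y → CX.#chains (crossIn y) (suc r)) + n * K ^ suc r
        ≡⟨ cong (λ s → c * s + n * K ^ suc r) (sym (#stars≡Σ-#chains r)) ⟩
      c * #stars (suc r) + n * K ^ suc r ∎

  assemble : ∀ {m t} d (A H : Vec (Fin n) m) (B L : Vec (Fin n) t) → isPair A B ≡ true →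
    CX.isChain (CX.extensions (commonIn B) A) L ≡ true → CY.isChain (CY.extensions (commonOut A) B) H ≡ true →
    SplitPathPower T X (t + m)
  assemble {m} {t} d A H B L pair L-chain H-chain = record
    { xs        = xs
    ; ys        = ys
    ; xs∈X      = λ i<t+m → X-entry (swap< i<t+m)
    ; ys∉X      = λ q<t+m → not≡true⇒≡false (Y-entry q<t+m)
    ; xs-adj    = λ i<j j<t+m → CX.isChain⇒adj X d (A ++ L) X-chain i<j (swap< j<t+m)
    ; ys-adj    = λ p<q q<t+m → CY.isChain⇒adj Y d (B ++ H) Y-chain p<q q<t+m
    ; xs-ys-adj = xs-ys-adj
    }
    where
    xs ys : ℕ → Fin n
    xs = nth d (A ++ L)
    ys = nth d (B ++ H)
    swap< : ∀ {i} → i < t + m → i < m + t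
    swap< {i} = subst (i <_) (+-comm t m)
    AL-chain : CX.isChain (commonIn B) (A ++ L) ≡ true
    AL-chain = trans (CX.isChain-++ (commonIn B) A L)
      (∧-intro (∧-conicalʳ (CY.isChain Y B) _ (trans (sym (isPair-sym A B)) pair)) L-chain)
    BH-chain : CY.isChain (commonOut A) (B ++ H) ≡ true
    BH-chain = trans (CY.isChain-++ (commonOut A) B H) (∧-intro (∧-conicalʳ (CX.isChain X A) _ pair) H-chain)
    X-chain : CX.isChain X (A ++ L) ≡ true
    X-chain = CX.isChain-mono-⊆ (A ++ L) (∩-⊆ˡ X _) AL-chain
    Y-chain : CY.isChain Y (B ++ H) ≡ true
    Y-chain = CY.isChain-mono-⊆ (B ++ H) (∩-⊆ˡ Y _) BH-chain
    xs∈commonIn : ∀ {i} → i < m + t → commonIn B (xs i) ≡ true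
    xs∈commonIn = CX.isChain⇒nth∈ (commonIn B) d (A ++ L) AL-chain
    X-entry : ∀ {i} → i < m + t → X (xs i) ≡ true
    X-entry {i} i<m+t = ∧-conicalˡ (X (xs i)) _ (xs∈commonIn i<m+t)
    ys∈commonOut : ∀ {q} → q < t + m → commonOut A (ys q) ≡ true
    ys∈commonOut = CY.isChain⇒nth∈ (commonOut A) d (B ++ H) BH-chain
    Y-entry : ∀ {q} → q < t + m → Y (ys q) ≡ true
    Y-entry {q} q<t+m = ∧-conicalˡ (Y (ys q)) _ (ys∈commonOut q<t+m)
    xs-ys-adj : ∀ {i q} → q + i < t + m → adj T (xs i) (ys q) ≡ true
    xs-ys-adj {i} {q} q+i<t+m with i <? m
    ... | yes i<m = subst (λ x → adj T x (ys q) ≡ true) (sym (nth-++ˡ d A L i<m))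
      (cross⇒adj (allIn⇒nth (crossIn (ys q)) d A (∧-conicalʳ (Y (ys q)) _ (ys∈commonOut q<t+m)) i<m))
      where
      q<t+m : q < t + m
      q<t+m = ≤-<-trans (m≤m+n q i) q+i<t+m
    ... | no  i≮m = subst (λ y → adj T (xs i) y ≡ true) (sym (nth-++ˡ d B H q<t))
      (cross⇒adj (allIn⇒nth (cross (xs i)) d B (∧-conicalʳ (X (xs i)) _ (xs∈commonIn i<m+t)) q<t))
      where
      q<t : q < t
      q<t = +-cancelʳ-< m q t (≤-<-trans (+-monoʳ-≤ q (≮⇒≥ i≮m)) q+i<t+m)
      i<m+t : i < m + t
      i<m+t = swap< (≤-<-trans (m≤n+m i q) q+i<t+m)

  cross-edge : 0 < eXY T X → SplitPathPower T X 1
  cross-edge e>0 with sum>0⇒∃ n _ e>0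
  ... | x , Σ>0 with sum>0⇒∃ n _ Σ>0
  ...   | y , x→y>0 = record
    { xs        = λ _ → x
    ; ys        = λ _ → y
    ; xs∈X      = λ _ → ∧-conicalˡ (X x) _ x→y
    ; ys∉X      = λ _ → not≡true⇒≡false (∧-conicalˡ (not (X y)) _ (∧-conicalʳ (X x) _ x→y))
    ; xs-adj    = λ i<j j<1 → contradiction (<-≤-trans i<j (s≤s⁻¹ j<1)) n≮0
    ; ys-adj    = λ p<q q<1 → contradiction (<-≤-trans p<q (s≤s⁻¹ q<1)) n≮0
    ; xs-ys-adj = λ _ → cross⇒adj x→y
    }
    where
    x→y : cross x y ≡ true
    x→y = ⟦⟧>0⇒≡true x→y>0

  -- Ly and Lx leave room, in a pair thin on neither side, for a Y-chain of length m after B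
  -- and an X-chain of length t after A.
  module Pairs (m′ t′ : ℕ) where
    m t Lx Ly : ℕ
    m  = suc m′
    t  = suc t′
    Lx = suc (chainThreshold t)
    Ly = suc (chainThreshold m)

    ΣΣ : (Vec (Fin n) m → Vec (Fin n) t → ℕ) → ℕ
    ΣΣ f = sumVec m (λ A → sumVec t (f A))

    yThin xThin : Vec (Fin n) m → Vec (Fin n) t → Bool
    yThin A B = card (CY.extensions (commonOut A) B) <ᵇ Ly
    xThin A B = card (CX.extensions (commonIn B) A) <ᵇ Lx

    isFat : Vec (Fin n) m → Vec (Fin n) t → Bool
    isFat A B = isPair A B ∧ (not (yThin A B) ∧ not (xThin A B))

    #pairs #yThin #xThin #fat : ℕ
    #pairs = ΣΣ (λ A B → ⟦ isPair A B ⟧)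
    #yThin = ΣΣ (λ A B → ⟦ isPair A B ∧ yThin A B ⟧)
    #xThin = ΣΣ (λ A B → ⟦ isPair A B ∧ xThin A B ⟧)
    #fat   = ΣΣ (λ A B → ⟦ isFat A B ⟧)

    ΣΣ-by-A : ∀ (P : Vec (Fin n) m → Vec (Fin n) t → Bool) →
      ΣΣ (λ A B → ⟦ CX.isChain X A ∧ P A B ⟧) ≡ sumVec m (λ A → ⟦ CX.isChain X A ⟧ * sumVec t (⟦_⟧ ∘ P A))
    ΣΣ-by-A P = sumVec-cong m (λ A →
      trans (sumVec-cong t (λ B → ⟦∧⟧≡* (CX.isChain X A) (P A B)))
            (*-distribˡ-sumVec t ⟦ CX.isChain X A ⟧ (⟦_⟧ ∘ P A)))

    ΣΣ-by-B : ∀ (P : Vec (Fin n) m → Vec (Fin n) t → Bool) →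
      ΣΣ (λ A B → ⟦ CY.isChain Y B ∧ P A B ⟧) ≡ sumVec t (λ B → ⟦ CY.isChain Y B ⟧ * sumVec m (λ A → ⟦ P A B ⟧))
    ΣΣ-by-B P = trans (sumVec-comm m t (λ A B → ⟦ CY.isChain Y B ∧ P A B ⟧)) (sumVec-cong t (λ B →
      trans (sumVec-cong m (λ A → ⟦∧⟧≡* (CY.isChain Y B) (P A B)))
            (*-distribˡ-sumVec m ⟦ CY.isChain Y B ⟧ (λ A → ⟦ P A B ⟧))))

    #pairs≡ΣA : #pairs ≡ sumVec m (λ A → ⟦ CX.isChain X A ⟧ * CY.#chains (commonOut A) t)
    #pairs≡ΣA = ΣΣ-by-A (λ A → CY.isChain (commonOut A))

    #pairs≡ΣB : #pairs ≡ sumVec t (λ B → ⟦ CY.isChain Y B ⟧ * CX.#chains (commonIn B) m)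
    #pairs≡ΣB = trans (sumVec-cong m (λ A → sumVec-cong t (λ B → cong ⟦_⟧ (isPair-sym A B))))
                      (ΣΣ-by-B (λ A B → CX.isChain (commonIn B) A))

    #yThin≡ΣA : #yThin ≡ sumVec m (λ A → ⟦ CX.isChain X A ⟧ * CY.#thinChains (commonOut A) t Ly)
    #yThin≡ΣA = trans (sumVec-cong m (λ A → sumVec-cong t (λ B →
                        cong ⟦_⟧ (∧-assoc (CX.isChain X A) (CY.isChain (commonOut A) B) (yThin A B)))))
                      (ΣΣ-by-A (λ A B → CY.isChain (commonOut A) B ∧ yThin A B))

    #xThin≡ΣB : #xThin ≡ sumVec t (λ B → ⟦ CY.isChain Y B ⟧ * CX.#thinChains (commonIn B) m Lx)
    #xThin≡ΣB = trans (sumVec-cong m (λ A → sumVec-cong t (λ B →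
                        cong ⟦_⟧ (trans (cong (_∧ xThin A B) (isPair-sym A B))
                                        (∧-assoc (CY.isChain Y B) (CX.isChain (commonIn B) A) (xThin A B))))))
                      (ΣΣ-by-B (λ A B → CX.isChain (commonIn B) A ∧ xThin A B))

    #pairs≤#fat+#yThin+#xThin : #pairs ≤ #fat + #yThin + #xThin
    #pairs≤#fat+#yThin+#xThin = begin
      ΣΣ (λ A B → ⟦ isPair A B ⟧)     ≤⟨ sumVec-mono-≤ m (λ A → sumVec-mono-≤ t (pointwise A)) ⟩
      ΣΣ (λ A B → fat A B + y A B + x A B)
        ≡⟨ sumVec-cong m (λ A → trans (sumVec-distrib-+ t (λ B → fat A B + y A B) (x A))
                                       (cong (_+ sumVec t (x A)) (sumVec-distrib-+ t (fat A) (y A)))) ⟩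
      sumVec m (λ A → sumVec t (fat A) + sumVec t (y A) + sumVec t (x A))
        ≡⟨ trans (sumVec-distrib-+ m (λ A → sumVec t (fat A) + sumVec t (y A)) (λ A → sumVec t (x A)))
                 (cong (_+ #xThin) (sumVec-distrib-+ m (λ A → sumVec t (fat A)) (λ A → sumVec t (y A)))) ⟩
      #fat + #yThin + #xThin ∎
      where
      open ≤-Reasoning
      fat y x : Vec (Fin n) m → Vec (Fin n) t → ℕ
      fat A B = ⟦ isFat A B ⟧
      y   A B = ⟦ isPair A B ∧ yThin A B ⟧
      x   A B = ⟦ isPair A B ∧ xThin A B ⟧
      pointwise : ∀ A B → ⟦ isPair A B ⟧ ≤ fat A B + y A B + x A B
      pointwise A B with isPair A B | yThin A B | xThin A B
      ... | false | _     | _     = z≤n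
      ... | true  | true  | _     = s≤s z≤n
      ... | true  | false | true  = s≤s z≤n
      ... | true  | false | false = s≤s z≤n

    #pairs-bound : ∀ Z → 0 < n →
      (chainThreshold t + chainFactor t * Z) * n ^ m ≤ #stars m → Z * n ^ m ≤ #pairs
    #pairs-bound Z n>0 stars≥ =
      linear-bound-from-power t′ K {{chainFactor≢0 t}} {{N≢0}} ≤-refl (begin
        (K + c * Z) ^ t * (N ^ t′ * N)  ≡⟨ cong ((K + c * Z) ^ t *_) (*-comm (N ^ t′) N) ⟩
        (K + c * Z) ^ t * N ^ t         ≡⟨ sym (^-distribʳ-* (K + c * Z) N t) ⟩
        ((K + c * Z) * N) ^ t           ≤⟨ ^-monoˡ-≤ t stars≥ ⟩
        #stars m ^ t                    ≤⟨ power-mean-sumVec n m t′ star ⟩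
        N ^ t′ * sumVec m (λ A → star A ^ t) ≤⟨ *-monoʳ-≤ (N ^ t′) Σ-star^≤ ⟩
        N ^ t′ * (c * #pairs + N * K ^ t) ∎)
      where
      open ≤-Reasoning
      K c N : ℕ
      K = chainThreshold t
      c = chainFactor t
      N = n ^ m
      N≢0 : NonZero N
      N≢0 = m^n≢0 n m {{>-nonZero n>0}}
      star pairsAt : Vec (Fin n) m → ℕ
      star    A = ⟦ CX.isChain X A ⟧ * card (commonOut A)
      pairsAt A = ⟦ CX.isChain X A ⟧ * CY.#chains (commonOut A) t
      pointwise : ∀ A → star A ^ t ≤ c * pairsAt A + K ^ t
      pointwise A with CX.isChain X A
      ... | false = z≤n
      ... | true rewrite +-identityʳ (card (commonOut A)) | +-identityʳ (CY.#chains (commonOut A) t) =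
        CY.card^≤chainFactor*#chains+threshold^ t (commonOut A)
      Σ-star^≤ : sumVec m (λ A → star A ^ t) ≤ c * #pairs + N * K ^ t
      Σ-star^≤ = begin
        sumVec m (λ A → star A ^ t)
          ≤⟨ sumVec-mono-≤ m pointwise ⟩
        sumVec m (λ A → c * pairsAt A + K ^ t)
          ≡⟨ sumVec-distrib-+ m (λ A → c * pairsAt A) (λ _ → K ^ t) ⟩
        sumVec m (λ A → c * pairsAt A) + sumVec {n} m (λ _ → K ^ t)
          ≡⟨ cong₂ _+_ (trans (*-distribˡ-sumVec m c pairsAt) (cong (c *_) (sym #pairs≡ΣA)))
                       (sumVec-const {n} m (K ^ t)) ⟩
        c * #pairs + N * K ^ t ∎

    4*#yThin≤ : 4 * #yThin ≤ #pairs + n ^ m * (4 * thinExcess t′ Ly)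
    4*#yThin≤ = begin
      4 * #yThin ≡⟨ cong (4 *_) #yThin≡ΣA ⟩
      4 * sumVec m (λ A → ⟦ CX.isChain X A ⟧ * CY.#thinChains (commonOut A) t Ly)
        ≤⟨ CY.weighted-#thinChains≤ {m} t′ Ly (CX.isChain X) commonOut ⟩
      sumVec m (λ A → ⟦ CX.isChain X A ⟧ * CY.#chains (commonOut A) t) + n ^ m * (4 * thinExcess t′ Ly)
        ≡⟨ cong (_+ n ^ m * (4 * thinExcess t′ Ly)) (sym #pairs≡ΣA) ⟩
      #pairs + n ^ m * (4 * thinExcess t′ Ly) ∎
      where open ≤-Reasoning

    4*#xThin≤ : 4 * #xThin ≤ #pairs + n ^ t * (4 * thinExcess m′ Lx)
    4*#xThin≤ = begin
      4 * #xThin ≡⟨ cong (4 *_) #xThin≡ΣB ⟩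
      4 * sumVec t (λ B → ⟦ CY.isChain Y B ⟧ * CX.#thinChains (commonIn B) m Lx)
        ≤⟨ CX.weighted-#thinChains≤ {t} m′ Lx (CY.isChain Y) commonIn ⟩
      sumVec t (λ B → ⟦ CY.isChain Y B ⟧ * CX.#chains (commonIn B) m) + n ^ t * (4 * thinExcess m′ Lx)
        ≡⟨ cong (_+ n ^ t * (4 * thinExcess m′ Lx)) (sym #pairs≡ΣB) ⟩
      #pairs + n ^ t * (4 * thinExcess m′ Lx) ∎
      where open ≤-Reasoning

    fat-pair-exists : t′ ≤ m′ → 0 < n → edgeConstant m′ t′ ^ m * n ^ (m′ + m) ≤ eXY T X ^ m →
      ∃ λ A → ∃ λ B → isFat A B ≡ true
    fat-pair-exists t′≤m′ n>0 hyp with sumVec>0⇒∃ m _ #fat>0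
      where
      #pairs≥ : pairConstant m′ t′ * n ^ m ≤ #pairs
      #pairs≥ = #pairs-bound (pairConstant m′ t′) n>0 (#stars-bound m′ (starConstant m′ t′) n>0 hyp)
      n^t≤n^m : n ^ t ≤ n ^ m
      n^t≤n^m = ^-monoʳ-≤ n {{>-nonZero n>0}} (s≤s t′≤m′)
      #fat>0 : 0 < #fat
      #fat>0 = remainder>0 {#pairs} {#fat} {#yThin} {#xThin} {thinExcess t′ Ly} {thinExcess m′ Lx} {n ^ m}
                 #pairs≤#fat+#yThin+#xThin 4*#yThin≤
                 (≤-trans 4*#xThin≤ (+-monoʳ-≤ #pairs (*-monoˡ-≤ (4 * thinExcess m′ Lx) n^t≤n^m)))
                 #pairs≥ (m^n>0 n {{>-nonZero n>0}} m)
    ... | A , Σ>0 with sumVec>0⇒∃ t _ Σ>0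
    ...   | B , fat>0 = A , B , ⟦⟧>0⇒≡true fat>0

    fat⇒splitPathPower : ∀ A B → isFat A B ≡ true → SplitPathPower T X (t + m)
    fat⇒splitPathPower A@(a ∷ _) B fat = assemble a A (proj₁ H) B (proj₁ L) pair (proj₂ L) (proj₂ H)
      where
      pair : isPair A B ≡ true
      pair = ∧-conicalˡ (isPair A B) _ fat
      notThin : not (yThin A B) ∧ not (xThin A B) ≡ true
      notThin = ∧-conicalʳ (isPair A B) _ fat
      yExt xExt : VSet n
      yExt = CY.extensions (commonOut A) B
      xExt = CX.extensions (commonIn B) A
      H : ∃ λ H → CY.isChain yExt H ≡ true
      H = CY.chain-exists m yExt (<ᵇ≡false⇒≥ (not≡true⇒≡false (∧-conicalˡ (not (yThin A B)) _ notThin)))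
      L : ∃ λ L → CX.isChain xExt L ≡ true
      L = CX.chain-exists t xExt (<ᵇ≡false⇒≥ (not≡true⇒≡false (∧-conicalʳ (not (yThin A B)) _ notThin)))

    splitPathPower : t′ ≤ m′ → 0 < n → edgeConstant m′ t′ ^ m * n ^ (m′ + m) ≤ eXY T X ^ m →
      SplitPathPower T X (t + m)
    splitPathPower t′≤m′ n>0 hyp =
      let A , B , fat = fat-pair-exists t′≤m′ n>0 hyp in fat⇒splitPathPower A B fat

theorem4p1 : (k : ℕ) → 1 ≤ k →
    ∃ λ (C : ℕ) → ∀ (n : ℕ) → 1 ≤ n → (T : Tournament n) → (X : Part n) →
      C ^ ⌈ k /2⌉ * n ^ (2 * ⌈ k /2⌉ ∸ 1) ≤ eXY T X ^ ⌈ k /2⌉ →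
      ∃ λ (u : Fin (k + k) → Fin n) → GoodSeq T X k u
theorem4p1 (suc zero)    _ = 1 , λ n n>0 T X hyp →
  toGoodSeq (CrossChains.cross-edge T X
    (<-≤-trans n>0 (subst₂ _≤_ (trans (*-identityˡ (n ^ 1)) (*-identityʳ n)) (*-identityʳ (eXY T X)) hyp)))
theorem4p1 (suc (suc k)) _ = edgeConstant m′ t′ , λ n n>0 T X hyp →
  toGoodSeq (subst (SplitPathPower T X) (⌊n/2⌋+⌈n/2⌉≡n (suc (suc k)))
    (CrossChains.Pairs.splitPathPower T X m′ t′ (⌊n/2⌋≤⌈n/2⌉ k) n>0
      (subst (λ d → edgeConstant m′ t′ ^ suc m′ * n ^ d ≤ eXY T X ^ suc m′)
             (cong (m′ +_) (+-identityʳ (suc m′))) hyp)))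
  where
  m′ t′ : ℕ
  m′ = ⌈ k /2⌉
  t′ = ⌊ k /2⌋
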